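{- Let $\mathcal{A}$ be a finite family, with $q=|\mathcal{A}|\ge 2$, of permutations of the vertices of $M(2)$ all having the same number of blank spaces, and let $p$ be a positive integer. Let $l = 2\lceil \log_{q} p\rceil$, let $P$ be the least power of $q$ that is not less than $p$, and let $a = \alpha(H_{\mathcal{A},M(2)})/q$. Then there exists a family $\mathcal{F}_l$ of $p$ permutations of the vertices of $M(l)$ (with some number of blank spaces) such that \[ \alpha(H_{\mathcal{F}_l,M(l)}) \leq P\cdot a^{l/2}. \]
   Context: $M(m)$ (for even $m$) denotes the graph on $m$ vertices consisting of $m/2$ disjoint edges; $M(2)$ is a single edge. For a finite graph $G$ with $n$ vertices and an integer $b\ge 0$, a permutation of the vertices of $G$ with $b$ blank spaces is a sequence of length $n+b$ in which every vertex of $G$ appears exactly once and the remaining $b$ entries are a blank symbol $*$. Two such sequences $\pi,\sigma$ of equal length are $G$-different if there is a position $i$ such that $\pi(i),\sigma(i)$ are both vertices and $\{\pi(i),\sigma(i)\}$ is an edge of $G$. For a family $\mathcal{F}$ of such sequences of equal length, $H_{\mathcal{F},G}$ is the graph whose vertices are the members of $\mathcal{F}$, two being adjacent iff they are $G$-different; $\alpha$ denotes the independence number. -}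

module Defs where

open import Data.Nat using (ℕ; zero; suc; _+_; _*_; _^_; _≤_; _<_; _/_)
open import Data.Fin using (Fin; toℕ)
open import Data.Fin.Subset using (Subset; _∈_; ∣_∣)
open import Data.Maybe using (Maybe; just)
open import Data.Vec using (Vec; lookup)
open import Data.Product using (Σ; _×_; ∃; ∃-syntax)
open import Relation.Binary.PropositionalEquality using (_≡_; _≢_)
open import Relation.Nullary using (¬_)
import Data.Rational as ℚ

-- The graph M(m) on vertex set Fin m: edges {2i, 2i+1}, i.e. two distinct
-- vertices u, v are adjacent iff ⌊u/2⌋ = ⌊v/2⌋.  (Used for even m.)
MAdj : ∀ {m} → Fin m → Fin m → Set
MAdj u v = (u ≢ v) × (toℕ u / 2 ≡ toℕ v / 2)

-- A sequence of length L over the vertices of a graph on n vertices, with the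
-- blank symbol * represented by 'nothing'.
Seq : ℕ → ℕ → Set
Seq n L = Vec (Maybe (Fin n)) L

-- Permutation of the vertices (Fin n) with blank spaces: every vertex occurs
-- exactly once; all other entries are blank (so the number of blanks is L - n).
IsPermWithBlanks : ∀ {n L} → Seq n L → Set
IsPermWithBlanks {n} {L} s =
  (v : Fin n) → Σ (Fin L) λ i → (lookup s i ≡ just v) × ((j : Fin L) → lookup s j ≡ just v → j ≡ i)

MDifferent : ∀ {n L} → Seq n L → Seq n L → Set
MDifferent {n} {L} π σ =
  ∃[ i ] ∃[ u ] ∃[ v ] (lookup π i ≡ just u) × (lookup σ i ≡ just v) × MAdj u v

-- A family of r permutations of the vertices of M(n), all of length L
-- (i.e. with the same number L - n of blank spaces); a family is a set, so
-- its members are pairwise distinct.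
record Family (n r : ℕ) : Set where
  field
    len      : ℕ
    member   : Fin r → Seq n len
    isPerm   : (i : Fin r) → IsPermWithBlanks (member i)
    distinct : (i j : Fin r) → member i ≡ member j → i ≡ j
open Family public

-- Independent sets of H_{F,M(n)} (as subsets of the index set Fin r).
Independent : ∀ {n r} → Family n r → Subset r → Set
Independent {n} {r} F S =
  (i j : Fin r) → i ∈ S → j ∈ S → ¬ MDifferent (member F i) (member F j)

IsIndependenceNumber : ∀ {n r} → Family n r → ℕ → Set
IsIndependenceNumber {n} {r} F a =
  (Σ (Subset r) λ S → Independent F S × ∣ S ∣ ≡ a)
  × ((S : Subset r) → Independent F S → ∣ S ∣ ≤ a)

_^ℚ_ : ℚ.ℚ → ℕ → ℚ.ℚ
x ^ℚ zero = ℚ.1ℚ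
x ^ℚ suc k = x ℚ.* (x ^ℚ k)

IsCeilLog : ℕ → ℕ → ℕ → Set
IsCeilLog q p k = (p ≤ q ^ k) × ((j : ℕ) → j < k → q ^ j < p)

module Submission where

-- For families A of permutations of
-- M(m) and B of permutations of M(n), the product A ⊗ B is the family of
-- concatenations "a followed by b" (a ∈ A, b ∈ B), read as permutations of
-- M(m + n) = M(m) ⊔ M(n) with the vertices of M(n) shifted by m.  When m is
-- even, two concatenations are M(m+n)-different as soon as their left or
-- their right halves are, so an independent set S of A ⊗ B splits into
-- slices {b | ab ∈ S} that are independent in B, indexed by a set of a's that
-- is independent in A; hence α(A ⊗ B) ≤ α(A) · α(B).
--
-- Iterating, the k-th power of a family A of q permutations of M(2) is a
-- family of q^k permutations of M(2k) with α ≤ α(A)^k.  Since p ≤ q^k, its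
-- first p members form the required family F, and α(F) ≤ α(A)^k, which is
-- P · a^(l/2) = q^k · (α(A)/q)^k rewritten over the rationals.

open import Defs
open import Data.Nat using (ℕ; suc; _*_; _^_; _≤_; NonZero)
open import Data.Product using (Σ)
open import Data.Integer using (+_)
open import Data.Rational using (ℚ; _/_)
import Data.Rational as ℚ
import Data.Nat as ℕ

open import Data.Nat using (zero; _+_; z≤n)
import Data.Nat.Properties as ℕP
open import Data.Nat.DivMod using (+-distrib-/-∣ˡ; m*n/n≡m)
open import Data.Nat.Divisibility using (_∣_; ∣-refl)
open import Data.Fin using (Fin; toℕ; _↑ˡ_; _↑ʳ_; splitAt; combine; quotient; remainder)
  renaming (zero to fzero; suc to fsuc)
import Data.Fin.Properties as FinP
open import Data.Fin.Subset using (Subset; _∈_; _∉_; ∣_∣; Nonempty; ⊥)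
open import Data.Fin.Subset.Properties using (nonempty?; Empty-unique; ∣p∣≤n; ∣⊥∣≡0)
open import Data.Vec using (Vec; []; _∷_; _++_; lookup; concat; group)
import Data.Vec as Vec
import Data.Vec.Properties as VecP
open import Data.Maybe using (Maybe; just; nothing)
import Data.Maybe as Maybe
open import Data.Maybe.Properties using (just-injective)
import Data.Maybe.Properties as MaybeP
open import Data.Bool using (true; false)
open import Data.Product using (_,_; proj₁; proj₂; _×_)
open import Data.Empty using (⊥-elim)
open import Function using (Injective)
open import Relation.Binary.PropositionalEquality
  using (_≡_; _≢_; refl; sym; trans; cong; cong₂; subst; subst₂; module ≡-Reasoning)
open import Relation.Nullary using (yes; no; does)
import Data.Integer as ℤ
import Data.Integer.Properties as ℤP
open import Data.Rational using (toℚᵘ)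
import Data.Rational.Properties as ℚP
open import Data.Rational.Unnormalised using (ℚᵘ; mkℚᵘ; _≃_; *≡*; *≤*)
import Data.Rational.Unnormalised as ℚᵘ
import Data.Rational.Unnormalised.Properties as ℚᵘP
open import Algebra.Bundles using (CommutativeRing)
import Algebra.Properties.CommutativeSemiring.Exp as Exp
open Exp (CommutativeRing.commutativeSemiring ℚᵘP.+-*-commutativeRing)
  using (^-distrib-*; ^-congˡ) renaming (_^_ to _^ᵘ_)

data Side (m n : ℕ) : Fin (m + n) → Set where
  left  : (i : Fin m) → Side m n (i ↑ˡ n)
  right : (j : Fin n) → Side m n (m ↑ʳ j)

side : ∀ m n (x : Fin (m + n)) → Side m n x
side zero    n x = right x
side (suc m) n fzero = left fzero
side (suc m) n (fsuc x) with side m n x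
... | left i  = left (fsuc i)
... | right j = right j

↑ˡ≢↑ʳ : ∀ {m n} (i : Fin m) (j : Fin n) → i ↑ˡ n ≢ m ↑ʳ j
↑ˡ≢↑ʳ {m} {n} i j e with trans (sym (FinP.splitAt-↑ˡ m i n))
                               (trans (cong (splitAt m) e) (FinP.splitAt-↑ʳ m n j))
... | ()

-- Shifting both endpoints by an even number preserves adjacency in M(·);
-- this is where the evenness of the left factor is needed.
MAdj-↑ˡ : ∀ {m} n {u v : Fin m} → MAdj u v → MAdj (u ↑ˡ n) (v ↑ˡ n)
MAdj-↑ˡ n {u} {v} (u≢v , same) =
  (λ e → u≢v (FinP.↑ˡ-injective n u v e)) ,
  trans (cong (ℕ._/ 2) (FinP.toℕ-↑ˡ u n)) (trans same (cong (ℕ._/ 2) (sym (FinP.toℕ-↑ˡ v n))))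

MAdj-↑ʳ : ∀ {m n} → 2 ∣ m → {u v : Fin n} → MAdj u v → MAdj (m ↑ʳ u) (m ↑ʳ v)
MAdj-↑ʳ {m} 2∣m {u} {v} (u≢v , same) = (λ e → u≢v (FinP.↑ʳ-injective m u v e)) , shift
  where
  open ≡-Reasoning
  shift : toℕ (m ↑ʳ u) ℕ./ 2 ≡ toℕ (m ↑ʳ v) ℕ./ 2
  shift = begin
    toℕ (m ↑ʳ u) ℕ./ 2        ≡⟨ cong (ℕ._/ 2) (FinP.toℕ-↑ʳ m u) ⟩
    (m + toℕ u) ℕ./ 2         ≡⟨ +-distrib-/-∣ˡ (toℕ u) 2∣m ⟩
    m ℕ./ 2 + toℕ u ℕ./ 2     ≡⟨ cong (λ x → m ℕ./ 2 + x) same ⟩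
    m ℕ./ 2 + toℕ v ℕ./ 2     ≡⟨ +-distrib-/-∣ˡ (toℕ v) 2∣m ⟨
    (m + toℕ v) ℕ./ 2         ≡⟨ cong (ℕ._/ 2) (FinP.toℕ-↑ʳ m v) ⟨
    toℕ (m ↑ʳ v) ℕ./ 2        ∎

join : ∀ {m n L₁ L₂} → Seq m L₁ → Seq n L₂ → Seq (m + n) (L₁ + L₂)
join {m} {n} s t = Vec.map (Maybe.map (_↑ˡ n)) s ++ Vec.map (Maybe.map (m ↑ʳ_)) t

lookup-joinˡ : ∀ {m n L₁ L₂} (s : Seq m L₁) (t : Seq n L₂) i →
  lookup (join s t) (i ↑ˡ L₂) ≡ Maybe.map (_↑ˡ n) (lookup s i)
lookup-joinˡ {m} {n} s t i =
  trans (VecP.lookup-++ˡ (Vec.map (Maybe.map (_↑ˡ n)) s) (Vec.map (Maybe.map (m ↑ʳ_)) t) i) (VecP.lookup-map i _ s)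

lookup-joinʳ : ∀ {m n L₁ L₂} (s : Seq m L₁) (t : Seq n L₂) i →
  lookup (join s t) (L₁ ↑ʳ i) ≡ Maybe.map (m ↑ʳ_) (lookup t i)
lookup-joinʳ {m} {n} s t i =
  trans (VecP.lookup-++ʳ (Vec.map (Maybe.map (_↑ˡ n)) s) (Vec.map (Maybe.map (m ↑ʳ_)) t) i) (VecP.lookup-map i _ t)

map-injective : ∀ {A B : Set} {f : A → B} → Injective _≡_ _≡_ f →
  ∀ {L} {xs ys : Vec A L} → Vec.map f xs ≡ Vec.map f ys → xs ≡ ys
map-injective f-inj {xs = []}     {[]}     _ = refl
map-injective f-inj {xs = x ∷ xs} {y ∷ ys} e =
  cong₂ _∷_ (f-inj (VecP.∷-injectiveˡ e)) (map-injective f-inj (VecP.∷-injectiveʳ e))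

join-injective : ∀ {m n L₁ L₂} {s s' : Seq m L₁} {t t' : Seq n L₂} →
  join s t ≡ join s' t' → (s ≡ s') × (t ≡ t')
join-injective {m} {n} {s = s} e =
  map-injective (MaybeP.map-injective (FinP.↑ˡ-injective n _ _)) (VecP.++-injectiveˡ _ _ e) ,
  map-injective (MaybeP.map-injective (FinP.↑ʳ-injective m _ _)) (VecP.++-injectiveʳ (Vec.map _ s) _ e)

left∉right : ∀ {m n} (x : Maybe (Fin n)) (u : Fin m) → Maybe.map (m ↑ʳ_) x ≢ just (u ↑ˡ n)
left∉right (just w) u e = ↑ˡ≢↑ʳ u w (sym (just-injective e))
left∉right nothing  u ()

right∉left : ∀ {m n} (x : Maybe (Fin m)) (w : Fin n) → Maybe.map (_↑ˡ n) x ≢ just (m ↑ʳ w)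
right∉left (just u) w e = ↑ˡ≢↑ʳ u w (just-injective e)
right∉left nothing  w ()

OccursOnceAt : ∀ {n L} → Seq n L → Fin n → Fin L → Set
OccursOnceAt s v i = (lookup s i ≡ just v) × (∀ j → lookup s j ≡ just v → j ≡ i)

occursOnce-joinˡ : ∀ {m n L₁ L₂} (s : Seq m L₁) (t : Seq n L₂) {u i} →
  OccursOnceAt s u i → OccursOnceAt (join s t) (u ↑ˡ n) (i ↑ˡ L₂)
occursOnce-joinˡ {n = n} {L₁} {L₂} s t {u} (at , unique) =
  trans (lookup-joinˡ s t _) (cong (Maybe.map (_↑ˡ n)) at) , only
  where
  only : ∀ j → lookup (join s t) j ≡ just (u ↑ˡ n) → j ≡ _
  only j e with side L₁ L₂ j
  ... | left j' = cong (_↑ˡ L₂) (unique j'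
          (MaybeP.map-injective (FinP.↑ˡ-injective n _ _) (trans (sym (lookup-joinˡ s t j')) e)))
  ... | right j' = ⊥-elim (left∉right (lookup t j') u (trans (sym (lookup-joinʳ s t j')) e))

occursOnce-joinʳ : ∀ {m n L₁ L₂} (s : Seq m L₁) (t : Seq n L₂) {w i} →
  OccursOnceAt t w i → OccursOnceAt (join s t) (m ↑ʳ w) (L₁ ↑ʳ i)
occursOnce-joinʳ {m} {L₁ = L₁} {L₂} s t {w} (at , unique) =
  trans (lookup-joinʳ s t _) (cong (Maybe.map (m ↑ʳ_)) at) , only
  where
  only : ∀ j → lookup (join s t) j ≡ just (m ↑ʳ w) → j ≡ _
  only j e with side L₁ L₂ j
  ... | right j' = cong (L₁ ↑ʳ_) (unique j'
          (MaybeP.map-injective (FinP.↑ʳ-injective m _ _) (trans (sym (lookup-joinʳ s t j')) e)))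
  ... | left j' = ⊥-elim (right∉left (lookup s j') w (trans (sym (lookup-joinˡ s t j')) e))

join-isPerm : ∀ {m n L₁ L₂} (s : Seq m L₁) (t : Seq n L₂) →
  IsPermWithBlanks s → IsPermWithBlanks t → IsPermWithBlanks (join s t)
join-isPerm {m} {n} s t perm-s perm-t v with side m n v
... | left u  = let (i , once) = perm-s u in i ↑ˡ _ , occursOnce-joinˡ s t once
... | right w = let (i , once) = perm-t w in _ ↑ʳ i , occursOnce-joinʳ s t once

join-differentˡ : ∀ {m n L₁ L₂} (s s' : Seq m L₁) (t t' : Seq n L₂) →
  MDifferent s s' → MDifferent (join s t) (join s' t')
join-differentˡ {n = n} s s' t t' (i , u , v , at-s , at-s' , adj) =
  i ↑ˡ _ , u ↑ˡ n , v ↑ˡ n ,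
  trans (lookup-joinˡ s t i) (cong (Maybe.map (_↑ˡ n)) at-s) ,
  trans (lookup-joinˡ s' t' i) (cong (Maybe.map (_↑ˡ n)) at-s') ,
  MAdj-↑ˡ n adj

join-differentʳ : ∀ {m n L₁ L₂} → 2 ∣ m → (s s' : Seq m L₁) (t t' : Seq n L₂) →
  MDifferent t t' → MDifferent (join s t) (join s' t')
join-differentʳ {m} 2∣m s s' t t' (i , u , v , at-t , at-t' , adj) =
  _ ↑ʳ i , m ↑ʳ u , m ↑ʳ v ,
  trans (lookup-joinʳ s t i) (cong (Maybe.map (m ↑ʳ_)) at-t) ,
  trans (lookup-joinʳ s' t' i) (cong (Maybe.map (m ↑ʳ_)) at-t') ,
  MAdj-↑ʳ 2∣m adj

_⊗_ : ∀ {m n q r} → Family m q → Family n r → Family (m + n) (q * r)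
_⊗_ {q = q} {r} A B = record
  { len      = len A + len B
  ; member   = product
  ; isPerm   = λ i → join-isPerm (member A (quotient {q} r i)) (member B (remainder {q} r i))
                                  (isPerm A (quotient {q} r i)) (isPerm B (remainder {q} r i))
  ; distinct = distinct-product
  }
  where
  product : Fin (q * r) → Seq _ (len A + len B)
  product i = join (member A (quotient {q} r i)) (member B (remainder {q} r i))
  distinct-product : ∀ i j → product i ≡ product j → i ≡ j
  distinct-product i j e with join-injective e
  ... | eqA , eqB = begin
    i                                               ≡⟨ FinP.combine-remQuot {q} r i ⟨
    combine (quotient {q} r i) (remainder {q} r i)  ≡⟨ cong₂ combine (distinct A _ _ eqA) (distinct B _ _ eqB) ⟩
    combine (quotient {q} r j) (remainder {q} r j)  ≡⟨ FinP.combine-remQuot {q} r j ⟩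
    j                                               ∎
    where open ≡-Reasoning

member-⊗ : ∀ {m n q r} (A : Family m q) (B : Family n r) a b →
  member (A ⊗ B) (combine a b) ≡ join (member A a) (member B b)
member-⊗ A B a b = cong (λ ab → join (member A (proj₁ ab)) (member B (proj₂ ab))) (FinP.remQuot-combine a b)

IndependenceBound : ∀ {n r} → Family n r → ℕ → Set
IndependenceBound {r = r} F M = (S : Subset r) → Independent F S → ∣ S ∣ ≤ M

∣++∣ : ∀ {m n} (s : Subset m) (t : Subset n) → ∣ s ++ t ∣ ≡ ∣ s ∣ + ∣ t ∣
∣++∣ []          t = refl
∣++∣ (true ∷ s)  t = cong suc (∣++∣ s t)
∣++∣ (false ∷ s) t = ∣++∣ s t

support : ∀ {q r} → Vec (Subset r) q → Subset q
support = Vec.map (λ s → does (nonempty? s))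

support⇒nonempty : ∀ {q r} (Ss : Vec (Subset r) q) a → a ∈ support Ss → Nonempty (lookup Ss a)
support⇒nonempty Ss a a∈ with nonempty? (lookup Ss a) | trans (sym (VecP.lookup-map a _ Ss)) (VecP.[]=⇒lookup a∈)
... | yes ne | _ = ne
... | no _   | ()

∣concat∣≤ : ∀ {q r} (Ss : Vec (Subset r) q) N → (∀ a → ∣ lookup Ss a ∣ ≤ N) →
  ∣ concat Ss ∣ ≤ ∣ support Ss ∣ * N
∣concat∣≤ []       N small = z≤n
∣concat∣≤ {r = r} (s ∷ Ss) N small rewrite ∣++∣ s (concat Ss) with nonempty? s
... | yes _ = ℕP.+-mono-≤ (small fzero) (∣concat∣≤ Ss N (λ a → small (fsuc a)))
... | no ¬ne rewrite Empty-unique ¬ne | ∣⊥∣≡0 r = ∣concat∣≤ Ss N (λ a → small (fsuc a))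

∈-concat : ∀ {q r} (Ss : Vec (Subset r) q) a {b} → b ∈ lookup Ss a → combine a b ∈ concat Ss
∈-concat Ss a {b} b∈ = VecP.lookup⇒[]= _ (concat Ss) (trans (VecP.lookup-concat Ss a b) (VecP.[]=⇒lookup b∈))

⊗-bound : ∀ {m n q r M N} → 2 ∣ m → (A : Family m q) (B : Family n r) →
  IndependenceBound A M → IndependenceBound B N → IndependenceBound (A ⊗ B) (M * N)
⊗-bound {q = q} {r} {M} {N} 2∣m A B bound-A bound-B S indep with group q r S
... | Ss , refl =
  ℕP.≤-trans (∣concat∣≤ Ss N slice-bound) (ℕP.*-monoˡ-≤ N (bound-A (support Ss) support-indep))
  where
  different : ∀ {a a' b b'} → MDifferent (join (member A a) (member B b)) (join (member A a') (member B b'))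
    → MDifferent (member (A ⊗ B) (combine a b)) (member (A ⊗ B) (combine a' b'))
  different = subst₂ MDifferent (sym (member-⊗ A B _ _)) (sym (member-⊗ A B _ _))
  -- each slice {b | combine a b ∈ S} is independent in B, since its members share the left half
  slice-bound : ∀ a → ∣ lookup Ss a ∣ ≤ N
  slice-bound a = bound-B (lookup Ss a) λ b b' b∈ b'∈ diff →
    indep _ _ (∈-concat Ss a b∈) (∈-concat Ss a b'∈)
      (different (join-differentʳ 2∣m (member A a) (member A a) (member B b) (member B b') diff))
  support-indep : Independent A (support Ss)
  support-indep a a' a∈ a'∈ diff with support⇒nonempty Ss a a∈ | support⇒nonempty Ss a' a'∈
  ... | b , b∈ | b' , b'∈ =
    indep _ _ (∈-concat Ss a b∈) (∈-concat Ss a' b'∈)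
      (different (join-differentˡ (member A a) (member A a') (member B b) (member B b') diff))

unit : Family 0 1
unit = record { len = 0 ; member = λ _ → [] ; isPerm = λ _ () ; distinct = λ { fzero fzero _ → refl } }

_^⊗_ : ∀ {m q} → Family m q → (k : ℕ) → Family (k * m) (q ^ k)
A ^⊗ zero  = unit
A ^⊗ suc k = A ⊗ (A ^⊗ k)

^⊗-bound : ∀ {m q M} → 2 ∣ m → (A : Family m q) → IndependenceBound A M →
  ∀ k → IndependenceBound (A ^⊗ k) (M ^ k)
^⊗-bound 2∣m A bound zero      S _ = ∣p∣≤n S
^⊗-bound 2∣m A bound (suc k) = ⊗-bound 2∣m A (A ^⊗ k) bound (^⊗-bound 2∣m A bound k)

BoundedFamily : ℕ → ℕ → ℕ → Set
BoundedFamily n r M = Σ (Family n r) λ F → IndependenceBound F M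

restrict : ∀ {n r M} p → p ≤ r → BoundedFamily n r M → BoundedFamily n p M
restrict {n} {M = M} p p≤r with ℕP.m≤n⇒∃[o]m+o≡n p≤r
... | d , refl = λ (F , bound) → first F , λ S indep → ∣S∣≤M F bound S indep
  where
  first : Family n (p + d) → Family n p
  first F = record
    { len = len F ; member = λ i → member F (i ↑ˡ d) ; isPerm = λ i → isPerm F (i ↑ˡ d)
    ; distinct = λ i j e → FinP.↑ˡ-injective d i j (distinct F _ _ e) }
  padded∈ : ∀ (S : Subset p) i → i ↑ˡ d ∈ (S ++ ⊥) → i ∈ S
  padded∈ S i i∈ = VecP.lookup⇒[]= i S (trans (sym (VecP.lookup-++ˡ S ⊥ i)) (VecP.[]=⇒lookup i∈))
  padding∉ : ∀ (S : Subset p) j → p ↑ʳ j ∉ (S ++ ⊥)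
  padding∉ S j j∈ with trans (sym (trans (VecP.lookup-++ʳ S ⊥ j) (VecP.lookup-replicate j false))) (VecP.[]=⇒lookup j∈)
  ... | ()
  ∣S∣≤M : ∀ F → IndependenceBound F M → ∀ S → Independent (first F) S → ∣ S ∣ ≤ M
  ∣S∣≤M F bound S indep = subst (_≤ M) size (bound (S ++ ⊥) padded-indep)
    where
    size : ∣ S ++ ⊥ ∣ ≡ ∣ S ∣
    size = trans (∣++∣ S ⊥) (trans (cong (λ x → ∣ S ∣ + x) (∣⊥∣≡0 d)) (ℕP.+-identityʳ _))
    padded-indep : Independent F (S ++ ⊥)
    padded-indep i j i∈ j∈ with side p d i | side p d j
    ... | left i' | left j'  = indep i' j' (padded∈ S i' i∈) (padded∈ S j' j∈)
    ... | right i' | _       = ⊥-elim (padding∉ S i' i∈)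
    ... | left _  | right j' = ⊥-elim (padding∉ S j' j∈)

ι : ℕ → ℚᵘ
ι n = mkℚᵘ (+ n) 0

ι-* : ∀ m n → ι (m * n) ≃ ι m ℚᵘ.* ι n
ι-* m n = ℚᵘP.≃-reflexive (cong (λ z → mkℚᵘ z 0) (ℤP.pos-* m n))

ι-^ : ∀ m k → ι (m ^ k) ≃ ι m ^ᵘ k
ι-^ m zero    = ℚᵘP.≃-refl
ι-^ m (suc k) = ℚᵘP.≃-trans (ι-* m (m ^ k)) (ℚᵘP.*-congˡ {ι m} (ι-^ m k))

ι-mono-≤ : ∀ {m n} → m ≤ n → ι m ℚᵘ.≤ ι n
ι-mono-≤ m≤n = *≤* (subst₂ ℤ._≤_ (sym (ℤP.*-identityʳ _)) (sym (ℤP.*-identityʳ _)) (ℤ.+≤+ m≤n))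

ι-*-cancel : ∀ q' a → ι (suc q') ℚᵘ.* mkℚᵘ (+ a) q' ≃ ι a
ι-*-cancel q' a = *≡* (trans (ℤP.*-identityʳ _)
  (trans (ℤP.*-comm (+ suc q') (+ a)) (cong (λ z → + a ℤ.* + suc z) (sym (ℕP.+-identityʳ q')))))

toℚᵘ-^ : ∀ x k → toℚᵘ (x ^ℚ k) ≃ toℚᵘ x ^ᵘ k
toℚᵘ-^ x zero    = ℚP.toℚᵘ-fromℚᵘ ℚᵘ.1ℚᵘ
toℚᵘ-^ x (suc k) = ℚᵘP.≃-trans (ℚP.toℚᵘ-homo-* x (x ^ℚ k)) (ℚᵘP.*-congˡ {toℚᵘ x} (toℚᵘ-^ x k))

scaledPower : ∀ q .{{_ : NonZero q}} a k → toℚᵘ (((+ (q ^ k)) / 1) ℚ.* (((+ a) / q) ^ℚ k)) ≃ ι (a ^ k)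
scaledPower (suc q') a k = begin
  toℚᵘ (((+ (q ^ k)) / 1) ℚ.* (r ^ℚ k))         ≈⟨ ℚP.toℚᵘ-homo-* ((+ (q ^ k)) / 1) (r ^ℚ k) ⟩
  toℚᵘ ((+ (q ^ k)) / 1) ℚᵘ.* toℚᵘ (r ^ℚ k)     ≈⟨ ℚᵘP.*-cong (ℚP.toℚᵘ-fromℚᵘ (ι (q ^ k))) (toℚᵘ-^ r k) ⟩
  ι (q ^ k) ℚᵘ.* toℚᵘ r ^ᵘ k                   ≈⟨ ℚᵘP.*-cong (ι-^ q k) (^-congˡ k (ℚP.toℚᵘ-fromℚᵘ r′)) ⟩
  ι q ^ᵘ k ℚᵘ.* r′ ^ᵘ k                         ≈⟨ ℚᵘP.≃-sym (^-distrib-* (ι q) r′ k) ⟩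
  (ι q ℚᵘ.* r′) ^ᵘ k                            ≈⟨ ^-congˡ k (ι-*-cancel q' a) ⟩
  ι a ^ᵘ k                                      ≈⟨ ℚᵘP.≃-sym (ι-^ a k) ⟩
  ι (a ^ k)                                     ∎
  where
  open ℚᵘP.≃-Reasoning
  q = suc q'
  r = (+ a) / q
  r′ = mkℚᵘ (+ a) q'

scaledPower-bound : ∀ q .{{_ : NonZero q}} a k {n} → n ≤ a ^ k →
  (+ n) / 1 ℚ.≤ ((+ (q ^ k)) / 1) ℚ.* (((+ a) / q) ^ℚ k)
scaledPower-bound q a k {n} n≤a^k = ℚP.toℚᵘ-cancel-≤ (begin
  toℚᵘ ((+ n) / 1)                            ≃⟨ ℚP.toℚᵘ-fromℚᵘ (ι n) ⟩
  ι n                                         ≤⟨ ι-mono-≤ n≤a^k ⟩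
  ι (a ^ k)                                   ≃⟨ scaledPower q a k ⟨
  toℚᵘ (((+ (q ^ k)) / 1) ℚ.* (((+ a) / q) ^ℚ k)) ∎)
  where open ℚᵘP.≤-Reasoning

half-double : ∀ k → 2 * k ℕ./ 2 ≡ k
half-double k = trans (cong (ℕ._/ 2) (ℕP.*-comm 2 k)) (m*n/n≡m k 2)

theorem6 : (q : ℕ) → .{{_ : NonZero q}} → 2 ≤ q → (A : Family 2 q)
    → (αA : ℕ) → IsIndependenceNumber A αA
    → (p : ℕ) → 1 ≤ p
    → (k : ℕ) → IsCeilLog q p k
    → let l = 2 * k in let P = q ^ k in let a = (+ αA) / q in
    Σ (Family l p) λ F → (αF : ℕ) → IsIndependenceNumber F αF
    → (+ αF) / 1 ℚ.≤ ((+ P) / 1) ℚ.* (a ^ℚ (l ℕ./ 2))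
theorem6 q _ A αA (_ , αA-maximal) p _ k (p≤q^k , _) = proj₁ F , αF-bound
  where
  power : BoundedFamily (k * 2) (q ^ k) (αA ^ k)
  power = A ^⊗ k , ^⊗-bound (∣-refl {2}) A αA-maximal k
  F : BoundedFamily (2 * k) p (αA ^ k)
  F = subst (λ n → BoundedFamily n p (αA ^ k)) (ℕP.*-comm k 2) (restrict p p≤q^k power)
  αF-bound : (αF : ℕ) → IsIndependenceNumber (proj₁ F) αF
    → (+ αF) / 1 ℚ.≤ ((+ (q ^ k)) / 1) ℚ.* (((+ αA) / q) ^ℚ (2 * k ℕ./ 2))
  αF-bound αF ((S , indep , refl) , _) =
    subst (λ e → (+ ∣ S ∣) / 1 ℚ.≤ ((+ (q ^ k)) / 1) ℚ.* (((+ αA) / q) ^ℚ e)) (sym (half-double k))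
          (scaledPower-bound q αA k (proj₂ F S indep))
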